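{- Let $p$ be a prime and let $A_1\subset\mathbb{F}_p$ satisfy $\frac{A_1-A_1}{A_1-A_1}=\mathbb{F}_p$. Then there exist elements $a_3,b_3,c_3,d_3\in A_1$ with $a_3\ne b_3$ such that for every constant $\kappa>0$ there is a constant $C_\kappa>0$ (depending only on $\kappa$, not on $p$ or $A_1$) such that every subset $A'''\subset A_1$ with $|A'''|\ge\kappa|A_1|$ satisfies \[|(b_3-a_3)A'''+(d_3-c_3)A'''|\ge C_\kappa^{ -1}\min\{|A_1|^2,p\}.\]
   Context: For $X\subset\mathbb{F}_p$, $\frac{X-X}{X-X}=\{\frac{x_1-x_2}{x_3-x_4}: x_1,x_2,x_3,x_4\in X,\ x_3\ne x_4\}$. For $\lambda\in\mathbb{F}_p$ and $X,Y\subset\mathbb{F}_p$, $\lambda X=\{\lambda x:x\in X\}$ and $X+Y=\{x+y:x\in X,y\in Y\}$.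
   Formalization: The constant κ ranges over the positive rationals. -}

module Defs where

open import Data.Nat as ℕ using (ℕ; NonZero; _+_; _*_; _∸_)
open import Data.Nat.DivMod using (_mod_)
open import Data.Fin using (Fin; toℕ)
open import Data.Fin.Properties using (any?; _≟_)
open import Data.Fin.Subset using (Subset; _∈_)
open import Data.Fin.Subset.Properties using (_∈?_)
open import Data.Vec using (tabulate)
open import Data.Bool using (Bool)
open import Data.Product using (∃; _×_)
open import Data.Integer using (+_)
open import Data.Rational using (ℚ; _/_)
open import Relation.Nullary using (¬_)
open import Relation.Nullary.Decidable using (⌊_⌋; _×-dec_)
open import Relation.Binary.PropositionalEquality using (_≡_)

𝔽 : ℕ → Set
𝔽 p = Fin p

module _ {p : ℕ} .{{_ : NonZero p}} where

  _⊕_ : 𝔽 p → 𝔽 p → 𝔽 p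
  x ⊕ y = (toℕ x + toℕ y) mod p

  _⊗_ : 𝔽 p → 𝔽 p → 𝔽 p
  x ⊗ y = (toℕ x * toℕ y) mod p

  _⊖_ : 𝔽 p → 𝔽 p → 𝔽 p
  x ⊖ y = (toℕ x + (p ∸ toℕ y)) mod p

  -- (X-X)/(X-X) = F_p : every t ∈ F_p equals (x₁-x₂)/(x₃-x₄) for some
  -- x₁,x₂,x₃,x₄ ∈ X with x₃ ≠ x₄; the quotient u/v (v ≠ 0) is the unique
  -- t with t·v = u.
  QuotientSetIsAll : Subset p → Set
  QuotientSetIsAll X =
    (t : 𝔽 p) → ∃ λ x₁ → ∃ λ x₂ → ∃ λ x₃ → ∃ λ x₄ →
      x₁ ∈ X × x₂ ∈ X × x₃ ∈ X × x₄ ∈ X × ¬ (x₃ ≡ x₄) ×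
      (t ⊗ (x₃ ⊖ x₄) ≡ x₁ ⊖ x₂)

  dilSum : 𝔽 p → Subset p → 𝔽 p → Subset p → Subset p
  dilSum l X m Y = tabulate λ z →
    ⌊ any? (λ x → any? (λ y →
        (x ∈? X) ×-dec ((y ∈? Y) ×-dec (((l ⊗ x) ⊕ (m ⊗ y)) ≟ z)))) ⌋

ℕ→ℚ : ℕ → ℚ
ℕ→ℚ n = (+ n) / 1

module Submission where

-- For a slope t let E(t) count the solutions of t·a + b = t·d + e with
-- a, b, d, e ∈ A₁.  A non-diagonal pair of pairs (a,b), (d,e) collides for at
-- most one slope (for none when a = d), so ∑_{t≠0} E(t) ≤ (p-1)|A₁|² + |A₁|⁴ and
-- averaging gives some t ≠ 0 with (p-1)·E(t) ≤ (p-1)|A₁|² + |A₁|⁴.  Write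
-- t = β/μ with β = b₃ - a₃, μ = d₃ - c₃ (then β ≠ 0 as t ≠ 0).  For A‴ ⊆ A₁ each
-- solution of β·a + μ·b = β·d + μ·e in A‴ is, after dividing by μ, a solution
-- of t·a + b = t·d + e in A₁; so the energy of βA‴ + μA‴ is at most E(t), and
-- Cauchy–Schwarz gives |A‴|⁴ ≤ |βA‴ + μA‴|·E(t).  Arithmetic with
-- |A₁| ≤ den(κ)·|A‴| concludes.

module FiniteSums where

  open import Data.Nat using (ℕ; zero; suc; _+_; _*_; _≤_; z≤n; s≤s)
  open import Data.Nat.Properties
  open import Data.Fin using (Fin; zero; suc)
  open import Data.Fin.Properties using () renaming (_≟_ to _≟ᶠ_; suc-injective to sucᶠ-injective; 0≢1+n to 0ᶠ≢1+n)
  open import Data.Fin.Subset using (Subset; ∣_∣; inside; outside)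
  open import Data.Fin.Subset.Properties using (_∈?_)
  open import Data.Vec using ([]; _∷_)
  open import Data.Bool using (if_then_else_)
  open import Data.Product using (∃; _×_; _,_)
  open import Data.Empty using (⊥-elim)
  open import Data.Sum using (inj₁; inj₂)
  open import Data.Nat.Tactic.RingSolver using (solve-∀)
  open import Relation.Nullary using (Dec; yes; no; does; ¬?)
  open import Relation.Binary.PropositionalEquality
  open import Function using (_∘_)
  open import Algebra.Properties.Semiring.Sum +-*-semiring
    using (sum; ∑-comm; ∑-distrib-+; *-distribˡ-sum; *-distribʳ-sum; sum-cong-≗)

  𝟙 : ∀ {a} {P : Set a} → Dec P → ℕ
  𝟙 d = if does d then 1 else 0

  𝟙≤1 : ∀ {a} {P : Set a} (d : Dec P) → 𝟙 d ≤ 1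
  𝟙≤1 (yes _) = s≤s z≤n
  𝟙≤1 (no _)  = z≤n

  𝟙-mono : ∀ {a b} {P : Set a} {Q : Set b} (d : Dec P) (e : Dec Q) → (P → Q) → 𝟙 d ≤ 𝟙 e
  𝟙-mono (yes p) (yes _) _   = ≤-refl
  𝟙-mono (yes p) (no ¬q) p⇒q = ⊥-elim (¬q (p⇒q p))
  𝟙-mono (no _)  _       _   = z≤n

  𝟙≢0⇒ : ∀ {a} {P : Set a} (d : Dec P) → 𝟙 d ≢ 0 → P
  𝟙≢0⇒ (yes p) _   = p
  𝟙≢0⇒ (no _)  1≢0 = ⊥-elim (1≢0 refl)

  isNonZero : ℕ → ℕ
  isNonZero n = 𝟙 (¬? (n ≟ 0))

  sum-mono : ∀ {n} {f g : Fin n → ℕ} → (∀ i → f i ≤ g i) → sum f ≤ sum g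
  sum-mono {zero}  f≤g = z≤n
  sum-mono {suc n} f≤g = +-mono-≤ (f≤g zero) (sum-mono (f≤g ∘ suc))

  sum-const : ∀ n c → sum {n} (λ _ → c) ≡ n * c
  sum-const zero    c = refl
  sum-const (suc n) c = cong (c +_) (sum-const n c)

  sum-zero : ∀ n → sum {n} (λ _ → 0) ≡ 0
  sum-zero n = trans (sum-const n 0) (*-zeroʳ n)

  sum-delta : ∀ {n} (g : Fin n → ℕ) (v : Fin n) → sum (λ z → g z * 𝟙 (v ≟ᶠ z)) ≡ g v
  sum-delta {suc n} g zero = begin
    g zero * 1 + sum (λ z → g (suc z) * 0) ≡⟨ cong₂ _+_ (*-identityʳ (g zero)) (sum-cong-≗ (λ z → *-zeroʳ (g (suc z)))) ⟩
    g zero + sum {n} (λ _ → 0)             ≡⟨ cong (g zero +_) (sum-zero n) ⟩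
    g zero + 0                             ≡⟨ +-identityʳ (g zero) ⟩
    g zero                                 ∎
    where open ≡-Reasoning
  sum-delta {suc n} g (suc v) = begin
    g zero * 0 + sum (λ z → g (suc z) * 𝟙 (suc v ≟ᶠ suc z)) ≡⟨ cong (_+ sum (λ z → g (suc z) * 𝟙 (v ≟ᶠ z))) (*-zeroʳ (g zero)) ⟩
    sum (λ z → g (suc z) * 𝟙 (v ≟ᶠ z))                      ≡⟨ sum-delta (g ∘ suc) v ⟩
    g (suc v)                                               ∎
    where open ≡-Reasoning

  sum≢0⇒ : ∀ {n} (f : Fin n → ℕ) → sum f ≢ 0 → ∃ λ i → f i ≢ 0
  sum≢0⇒ {zero}  f sum≢0 = ⊥-elim (sum≢0 refl)
  sum≢0⇒ {suc n} f sum≢0 with f zero ≟ 0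
  ... | no  f0≢0 = zero , f0≢0
  ... | yes f0≡0 with sum≢0⇒ (f ∘ suc) (λ rest≡0 → sum≢0 (cong₂ _+_ f0≡0 rest≡0))
  ...   | i , fi≢0 = suc i , fi≢0

  sum-𝟙-unique : ∀ {n ℓ} {P : Fin n → Set ℓ} (P? : ∀ i → Dec (P i)) →
    (∀ i j → P i → P j → i ≡ j) → sum (λ i → 𝟙 (P? i)) ≤ 1
  sum-𝟙-unique {zero}  P? unique = z≤n
  sum-𝟙-unique {suc n} P? unique with P? zero
  ... | no _   = sum-𝟙-unique (P? ∘ suc) (λ i j Pi Pj → sucᶠ-injective (unique (suc i) (suc j) Pi Pj))
  ... | yes P0 = ≤-reflexive (cong suc (trans (sum-cong-≗ rest≡0) (sum-zero n)))
    where
    rest≡0 : ∀ i → 𝟙 (P? (suc i)) ≡ 0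
    rest≡0 i with P? (suc i)
    ... | yes Pi = ⊥-elim (0ᶠ≢1+n (unique zero (suc i) P0 Pi))
    ... | no _   = refl

  indicator : ∀ {n} → Subset n → Fin n → ℕ
  indicator X x = 𝟙 (x ∈? X)

  indicator≤1 : ∀ {n} (X : Subset n) x → indicator X x ≤ 1
  indicator≤1 X x = 𝟙≤1 (x ∈? X)

  ∣X∣≡sum : ∀ {n} (X : Subset n) → ∣ X ∣ ≡ sum (indicator X)
  ∣X∣≡sum []           = refl
  ∣X∣≡sum (inside ∷ X)  = cong suc (∣X∣≡sum X)
  ∣X∣≡sum (outside ∷ X) = ∣X∣≡sum X

  Σ⟨_⟩ : ∀ {n} → (Fin n → ℕ) → (Fin n → ℕ) → ℕ
  Σ⟨ w ⟩ f = sum (λ x → w x * f x)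

  module _ {n : ℕ} (w : Fin n → ℕ) where

    Σ-cong : ∀ {f g : Fin n → ℕ} → (∀ x → f x ≡ g x) → Σ⟨ w ⟩ f ≡ Σ⟨ w ⟩ g
    Σ-cong f≡g = sum-cong-≗ (λ x → cong (w x *_) (f≡g x))

    Σ-*ˡ : ∀ c (f : Fin n → ℕ) → c * Σ⟨ w ⟩ f ≡ Σ⟨ w ⟩ (λ x → c * f x)
    Σ-*ˡ c f = trans (*-distribˡ-sum c (λ x → w x * f x))
      (sum-cong-≗ (λ x → trans (sym (*-assoc c (w x) (f x)))
        (trans (cong (_* f x) (*-comm c (w x))) (*-assoc (w x) c (f x)))))

    Σ-*ʳ : ∀ c (f : Fin n → ℕ) → Σ⟨ w ⟩ (λ x → f x * c) ≡ Σ⟨ w ⟩ f * c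
    Σ-*ʳ c f = trans (sum-cong-≗ (λ x → sym (*-assoc (w x) (f x) c)))
      (sym (*-distribʳ-sum c (λ x → w x * f x)))

    Σ-+ : ∀ (f g : Fin n → ℕ) → Σ⟨ w ⟩ (λ x → f x + g x) ≡ Σ⟨ w ⟩ f + Σ⟨ w ⟩ g
    Σ-+ f g = trans (sum-cong-≗ (λ x → *-distribˡ-+ (w x) (f x) (g x)))
      (∑-distrib-+ (λ x → w x * f x) (λ x → w x * g x))

    Σ-const : ∀ c → Σ⟨ w ⟩ (λ _ → c) ≡ sum w * c
    Σ-const c = sym (*-distribʳ-sum c w)

    Σ-sum : ∀ {m} (f : Fin m → Fin n → ℕ) →
      sum (λ t → Σ⟨ w ⟩ (f t)) ≡ Σ⟨ w ⟩ (λ x → sum (λ t → f t x))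
    Σ-sum f = trans (∑-comm (λ t x → w x * f t x))
      (sum-cong-≗ (λ x → sym (*-distribˡ-sum (w x) (λ t → f t x))))

  Σ-mono : ∀ {n} {w w′ f g : Fin n → ℕ} → (∀ x → w x ≤ w′ x) → (∀ x → f x ≤ g x) →
    Σ⟨ w ⟩ f ≤ Σ⟨ w′ ⟩ g
  Σ-mono w≤w′ f≤g = sum-mono (λ x → *-mono-≤ (w≤w′ x) (f≤g x))

  Σ≢0⇒ : ∀ {n} (w f : Fin n → ℕ) → Σ⟨ w ⟩ f ≢ 0 → ∃ λ x → w x ≢ 0 × f x ≢ 0
  Σ≢0⇒ w f Σ≢0 with sum≢0⇒ (λ x → w x * f x) Σ≢0
  ... | x , wxfx≢0 = x , (λ wx≡0 → wxfx≢0 (cong (_* f x) wx≡0))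
                       , (λ fx≡0 → wxfx≢0 (trans (cong (w x *_) fx≡0) (*-zeroʳ (w x))))

  Σ²⟨_⟩ : ∀ {n} → (Fin n → ℕ) → (Fin n → Fin n → ℕ) → ℕ
  Σ²⟨ w ⟩ F = Σ⟨ w ⟩ λ a → Σ⟨ w ⟩ λ b → F a b

  module _ {n : ℕ} (w : Fin n → ℕ) where

    Σ²-cong : ∀ {F G : Fin n → Fin n → ℕ} → (∀ a b → F a b ≡ G a b) → Σ²⟨ w ⟩ F ≡ Σ²⟨ w ⟩ G
    Σ²-cong F≡G = Σ-cong w (λ a → Σ-cong w (F≡G a))

    Σ²-*ˡ : ∀ c (F : Fin n → Fin n → ℕ) → c * Σ²⟨ w ⟩ F ≡ Σ²⟨ w ⟩ (λ a b → c * F a b)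
    Σ²-*ˡ c F = trans (Σ-*ˡ w c _) (Σ-cong w (λ a → Σ-*ˡ w c (F a)))

    Σ²-+ : ∀ (F G : Fin n → Fin n → ℕ) →
      Σ²⟨ w ⟩ (λ a b → F a b + G a b) ≡ Σ²⟨ w ⟩ F + Σ²⟨ w ⟩ G
    Σ²-+ F G = trans (Σ-cong w (λ a → Σ-+ w (F a) (G a))) (Σ-+ w _ _)

    Σ²-const : ∀ c → Σ²⟨ w ⟩ (λ _ _ → c) ≡ sum w * (sum w * c)
    Σ²-const c = trans (Σ-cong w (λ _ → Σ-const w c)) (Σ-const w _)

    Σ²-sum : ∀ {m} (F : Fin m → Fin n → Fin n → ℕ) →
      sum (λ t → Σ²⟨ w ⟩ (F t)) ≡ Σ²⟨ w ⟩ (λ a b → sum (λ t → F t a b))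
    Σ²-sum F = trans (Σ-sum w (λ t a → Σ⟨ w ⟩ (F t a))) (Σ-cong w (λ a → Σ-sum w (λ t → F t a)))

    Σ²-interchange : ∀ {m} (c : Fin m → ℕ) (F : Fin m → Fin n → Fin n → ℕ) →
      sum (λ t → c t * Σ²⟨ w ⟩ (F t)) ≡ Σ²⟨ w ⟩ (λ a b → sum (λ t → c t * F t a b))
    Σ²-interchange c F = trans (sum-cong-≗ (λ t → Σ²-*ˡ (c t) (F t))) (Σ²-sum (λ t a b → c t * F t a b))

    Σ²-delta : ∀ a b → Σ²⟨ w ⟩ (λ d e → 𝟙 (a ≟ᶠ d) * 𝟙 (b ≟ᶠ e)) ≡ w a * w b
    Σ²-delta a b = begin
      Σ⟨ w ⟩ (λ d → Σ⟨ w ⟩ (λ e → 𝟙 (a ≟ᶠ d) * 𝟙 (b ≟ᶠ e)))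
        ≡⟨ Σ-cong w (λ d → trans (sym (Σ-*ˡ w (𝟙 (a ≟ᶠ d)) (λ e → 𝟙 (b ≟ᶠ e))))
                                  (cong (𝟙 (a ≟ᶠ d) *_) (sum-delta w b))) ⟩
      Σ⟨ w ⟩ (λ d → 𝟙 (a ≟ᶠ d) * w b)
        ≡⟨ Σ-*ʳ w (w b) (λ d → 𝟙 (a ≟ᶠ d)) ⟩
      Σ⟨ w ⟩ (λ d → 𝟙 (a ≟ᶠ d)) * w b
        ≡⟨ cong (_* w b) (sum-delta w a) ⟩
      w a * w b ∎
      where open ≡-Reasoning

  Σ²-mono : ∀ {n} {w w′ : Fin n → ℕ} {F G : Fin n → Fin n → ℕ} → (∀ x → w x ≤ w′ x) →
    (∀ a b → F a b ≤ G a b) → Σ²⟨ w ⟩ F ≤ Σ²⟨ w′ ⟩ G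
  Σ²-mono w≤w′ F≤G = Σ-mono w≤w′ (λ a → Σ-mono w≤w′ (F≤G a))

  extend-average : ∀ w₀ W x f₀ R → W * x ≤ R → w₀ * x ≤ w₀ * f₀ → (w₀ + W) * x ≤ w₀ * f₀ + R
  extend-average w₀ W x f₀ R Wx≤R w₀x≤w₀f₀ =
    ≤-trans (≤-reflexive (*-distribʳ-+ x w₀ W)) (+-mono-≤ w₀x≤w₀f₀ Wx≤R)

  averaging : ∀ {n} (w f : Fin n → ℕ) → sum w ≢ 0 →
    ∃ λ i → w i ≢ 0 × sum w * f i ≤ Σ⟨ w ⟩ f
  averaging {zero}  w f sum≢0 = ⊥-elim (sum≢0 refl)
  averaging {suc n} w f sum≢0 with sum (w ∘ suc) ≟ 0
  ... | yes rest≡0 = zero , (λ w₀≡0 → sum≢0 (cong₂ _+_ w₀≡0 rest≡0)) ,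
    extend-average (w zero) _ (f zero) (f zero) _
      (≤-trans (≤-reflexive (cong (_* f zero) rest≡0)) z≤n) ≤-refl
  ... | no rest≢0 with averaging (w ∘ suc) (f ∘ suc) rest≢0
  ...   | j , wj≢0 , rest-average with f zero ≤? f (suc j) | w zero ≟ 0
  ...     | yes f₀≤fj | no w₀≢0 = zero , w₀≢0 ,
    extend-average (w zero) _ (f zero) (f zero) _ (≤-trans (*-monoʳ-≤ (sum (w ∘ suc)) f₀≤fj) rest-average) ≤-refl
  ...     | yes _ | yes w₀≡0 = suc j , wj≢0 , extend-average (w zero) _ (f (suc j)) (f zero) _ rest-average
    (≤-reflexive (trans (cong (_* f (suc j)) w₀≡0) (cong (_* f zero) (sym w₀≡0))))
  ...     | no f₀≰fj | _ = suc j , wj≢0 , extend-average (w zero) _ (f (suc j)) (f zero) _ rest-average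
    (*-monoʳ-≤ (w zero) (<⇒≤ (≰⇒> f₀≰fj)))

  square-cancel : ∀ x y → x * x ≤ y * y → x ≤ y
  square-cancel x y x²≤y² with x ≤? y
  ... | yes x≤y = x≤y
  ... | no  x≰y = ⊥-elim (<⇒≱ (*-mono-< (≰⇒> x≰y) (≰⇒> x≰y)) x²≤y²)

  -- AM–GM for ordered pairs: (x + (x + k))² = 4x(x + k) + k².
  amgm-ordered : ∀ x k → 4 * (x * (x + k)) ≤ (x + (x + k)) * (x + (x + k))
  amgm-ordered x k = subst (4 * (x * (x + k)) ≤_) (sym (expand x k)) (m≤m+n _ (k * k))
    where
    expand : ∀ x k → (x + (x + k)) * (x + (x + k)) ≡ 4 * (x * (x + k)) + k * k
    expand = solve-∀

  amgm : ∀ x y → 4 * (x * y) ≤ (x + y) * (x + y)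
  amgm x y with ≤-total x y
  ... | inj₁ x≤y with m≤n⇒∃[o]m+o≡n x≤y
  ...   | k , refl = amgm-ordered x k
  amgm x y | inj₂ y≤x with m≤n⇒∃[o]m+o≡n y≤x
  ...   | k , refl = subst₂ _≤_ (cong (4 *_) (*-comm y (y + k))) (cong (λ s → s * s) (+-comm y (y + k)))
                       (amgm-ordered y k)

  cross-term : ∀ a S K Q → S * S ≤ K * Q → 2 * (a * S) ≤ Q + K * (a * a)
  cross-term a S K Q S²≤KQ = square-cancel _ _ (begin
    (2 * (a * S)) * (2 * (a * S)) ≡⟨ square a S ⟩
    4 * ((a * a) * (S * S))       ≤⟨ *-monoʳ-≤ 4 (*-monoʳ-≤ (a * a) S²≤KQ) ⟩
    4 * ((a * a) * (K * Q))       ≡⟨ rearrange a K Q ⟩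
    4 * (Q * (K * (a * a)))       ≤⟨ amgm Q (K * (a * a)) ⟩
    (Q + K * (a * a)) * (Q + K * (a * a)) ∎)
    where
    open ≤-Reasoning
    square : ∀ a S → (2 * (a * S)) * (2 * (a * S)) ≡ 4 * ((a * a) * (S * S))
    square = solve-∀
    rearrange : ∀ a K Q → 4 * ((a * a) * (K * Q)) ≡ 4 * (Q * (K * (a * a)))
    rearrange = solve-∀

  -- Inductive step of Cauchy–Schwarz: adding a term a to a sum S with
  -- support size K and sum of squares Q.
  cauchy-schwarz-step : ∀ a S K Q → S * S ≤ K * Q →
    (a + S) * (a + S) ≤ (isNonZero a + K) * (a * a + Q)
  cauchy-schwarz-step zero      S K Q S²≤KQ = S²≤KQ
  cauchy-schwarz-step a@(suc _) S K Q S²≤KQ = subst₂ _≤_ (sym (lhs a S)) (sym (rhs a K Q))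
    (+-mono-≤ (+-monoʳ-≤ (a * a) (cross-term a S K Q S²≤KQ)) S²≤KQ)
    where
    lhs : ∀ a S → (a + S) * (a + S) ≡ a * a + 2 * (a * S) + S * S
    lhs = solve-∀
    rhs : ∀ a K Q → (1 + K) * (a * a + Q) ≡ a * a + (Q + K * (a * a)) + K * Q
    rhs = solve-∀

  cauchy-schwarz : ∀ {n} (f : Fin n → ℕ) →
    sum f * sum f ≤ sum (λ i → isNonZero (f i)) * sum (λ i → f i * f i)
  cauchy-schwarz {zero}  f = z≤n
  cauchy-schwarz {suc n} f = cauchy-schwarz-step (f zero) _ _ _ (cauchy-schwarz (f ∘ suc))

module Energy where

  open import Data.Nat using (ℕ; _*_; _≤_)
  open import Data.Nat.Properties
  open import Data.Fin using (Fin)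
  open import Data.Fin.Properties using () renaming (_≟_ to _≟ᶠ_)
  open import Data.Fin.Subset using (Subset; _∈_; ∣_∣)
  open import Data.Fin.Subset.Properties using (_∈?_)
  open import Relation.Nullary using (¬?)
  open import Relation.Binary.PropositionalEquality
  open import Algebra.Properties.Semiring.Sum +-*-semiring using (sum; sum-cong-≗)
  open FiniteSums

  module _ {n : ℕ} (v : Fin n → Fin n → Fin n) (w : Fin n → ℕ) where

    representations : Fin n → ℕ
    representations z = Σ²⟨ w ⟩ (λ a b → 𝟙 (v a b ≟ᶠ z))

    energy : ℕ
    energy = Σ²⟨ w ⟩ (λ a b → representations (v a b))

    -- Every pair (a, b) represents exactly one point: ∑_z r(z) = |w|².
    sum-representations : sum representations ≡ sum w * sum w
    sum-representations = begin
      sum representations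
        ≡⟨ Σ²-sum w (λ z a b → 𝟙 (v a b ≟ᶠ z)) ⟩
      Σ²⟨ w ⟩ (λ a b → sum (λ z → 𝟙 (v a b ≟ᶠ z)))
        ≡⟨ Σ²-cong w (λ a b → trans (sum-cong-≗ (λ z → sym (*-identityˡ (𝟙 (v a b ≟ᶠ z))))) (sum-delta (λ _ → 1) (v a b))) ⟩
      Σ²⟨ w ⟩ (λ _ _ → 1)
        ≡⟨ Σ²-const w 1 ⟩
      sum w * (sum w * 1)
        ≡⟨ cong (sum w *_) (*-identityʳ (sum w)) ⟩
      sum w * sum w ∎
      where open ≡-Reasoning

    sum-representations² : sum (λ z → representations z * representations z) ≡ energy
    sum-representations² =
      trans (Σ²-interchange w representations (λ z a b → 𝟙 (v a b ≟ᶠ z)))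
            (Σ²-cong w (λ a b → sum-delta representations (v a b)))

    energy-bound : (S : Subset n) → (∀ z → representations z ≢ 0 → z ∈ S) →
      (sum w * sum w) * (sum w * sum w) ≤ ∣ S ∣ * energy
    energy-bound S represented⇒∈S = begin
      (sum w * sum w) * (sum w * sum w)
        ≡⟨ sym (cong₂ _*_ sum-representations sum-representations) ⟩
      sum representations * sum representations
        ≤⟨ cauchy-schwarz representations ⟩
      sum (λ z → isNonZero (representations z)) * sum (λ z → representations z * representations z)
        ≤⟨ *-mono-≤ support≤∣S∣ (≤-reflexive sum-representations²) ⟩
      ∣ S ∣ * energy ∎
      where
      open ≤-Reasoning
      support≤∣S∣ : sum (λ z → isNonZero (representations z)) ≤ ∣ S ∣
      support≤∣S∣ = ≤-trans
        (sum-mono (λ z → 𝟙-mono (¬? (representations z ≟ 0)) (z ∈? S) (represented⇒∈S z)))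
        (≤-reflexive (sym (∣X∣≡sum S)))

  energy-mono : ∀ {n} (v v′ : Fin n → Fin n → Fin n) {w w′ : Fin n → ℕ} →
    (∀ x → w x ≤ w′ x) → (∀ a b d e → v d e ≡ v a b → v′ d e ≡ v′ a b) →
    energy v w ≤ energy v′ w′
  energy-mono v v′ w≤w′ collision = Σ²-mono w≤w′ (λ a b → Σ²-mono w≤w′ (λ d e →
    𝟙-mono (v d e ≟ᶠ v a b) (v′ d e ≟ᶠ v′ a b) (collision a b d e)))

module Residues where

  open import Data.Nat as ℕ using (ℕ; NonZero; zero; suc)
  import Data.Nat.Properties as ℕ
  open import Data.Nat.DivMod using (_mod_; _%_; _/_; m≡m%n+[m/n]*n; m%n<n)
  open import Data.Nat.Divisibility using (>⇒∤) renaming (_∣_ to _∣ℕ_)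
  open import Data.Nat.Primality using (Prime; euclidsLemma)
  open import Data.Integer using (ℤ; +_; _+_; _*_; _-_; -_; ∣_∣)
  import Data.Integer.Properties as ℤ
  open import Data.Integer.Divisibility.Signed
    using (_∣_; divides; ∣m∣n⇒∣m+n; ∣m∣n⇒∣m-n; ∣m⇒∣-m; ∣m⇒∣m*n; ∣n⇒∣m*n; ∣⇒∣ᵤ; ∣ᵤ⇒∣)
  open import Data.Integer.Tactic.RingSolver using (solve-∀)
  open import Data.Fin using (Fin; toℕ)
  open import Data.Fin.Properties using (toℕ-fromℕ<; toℕ-injective; toℕ<n)
  open import Data.Sum using (_⊎_; inj₁; inj₂; map)
  open import Data.Empty using (⊥; ⊥-elim)
  open import Relation.Binary.PropositionalEquality
  open import Relation.Binary.Bundles using (Setoid)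
  import Relation.Binary.Reasoning.Setoid as SetoidReasoning
  open import Defs using (_⊕_; _⊗_; _⊖_)

  module _ {p : ℕ} .{{_ : NonZero p}} where

    ι : Fin p → ℤ
    ι x = + toℕ x

    infix 4 _≡ₚ_
    record _≡ₚ_ (a b : ℤ) : Set where
      constructor mod-p
      field p∣a-b : + p ∣ a - b

    ≡ₚ-refl : ∀ {a} → a ≡ₚ a
    ≡ₚ-refl {a} = mod-p (divides (+ 0) (ℤ.+-inverseʳ a))

    ≡ₚ-sym : ∀ {a b} → a ≡ₚ b → b ≡ₚ a
    ≡ₚ-sym {a} {b} (mod-p a≡b) = mod-p (subst (+ p ∣_) (negate a b) (∣m⇒∣-m a≡b))
      where negate : ∀ a b → - (a - b) ≡ b - a
            negate = solve-∀

    ≡ₚ-trans : ∀ {a b c} → a ≡ₚ b → b ≡ₚ c → a ≡ₚ c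
    ≡ₚ-trans {a} {b} {c} (mod-p a≡b) (mod-p b≡c) = mod-p (subst (+ p ∣_) (telescope a b c) (∣m∣n⇒∣m+n a≡b b≡c))
      where telescope : ∀ a b c → (a - b) + (b - c) ≡ a - c
            telescope = solve-∀

    ≡ₚ-+ : ∀ {a b c d} → a ≡ₚ b → c ≡ₚ d → a + c ≡ₚ b + d
    ≡ₚ-+ {a} {b} {c} {d} (mod-p a≡b) (mod-p c≡d) = mod-p (subst (+ p ∣_) (regroup a b c d) (∣m∣n⇒∣m+n a≡b c≡d))
      where regroup : ∀ a b c d → (a - b) + (c - d) ≡ (a + c) - (b + d)
            regroup = solve-∀

    ≡ₚ-* : ∀ {a b c d} → a ≡ₚ b → c ≡ₚ d → a * c ≡ₚ b * d
    ≡ₚ-* {a} {b} {c} {d} (mod-p a≡b) (mod-p c≡d) =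
      mod-p (subst (+ p ∣_) (regroup a b c d) (∣m∣n⇒∣m+n (∣m⇒∣m*n c a≡b) (∣n⇒∣m*n b c≡d)))
      where regroup : ∀ a b c d → (a - b) * c + b * (c - d) ≡ a * c - b * d
            regroup = solve-∀

    ≡ₚ-setoid : Setoid _ _
    ≡ₚ-setoid = record
      { _≈_ = _≡ₚ_
      ; isEquivalence = record { refl = ≡ₚ-refl ; sym = ≡ₚ-sym ; trans = ≡ₚ-trans } }

    module ≡ₚ-Reasoning = SetoidReasoning ≡ₚ-setoid

    ι-mod : ∀ n → ι (n mod p) ≡ₚ + n
    ι-mod n = mod-p (divides (- + (n / p)) (begin
      + toℕ (n mod p) - + n
        ≡⟨ cong₂ (λ r m → + r - + m) (toℕ-fromℕ< (m%n<n n p)) (m≡m%n+[m/n]*n n p) ⟩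
      + (n % p) - + (n % p ℕ.+ n / p ℕ.* p)
        ≡⟨ cong (λ m → + (n % p) - m) (trans (ℤ.pos-+ (n % p) _) (cong (λ m → + (n % p) + m) (ℤ.pos-* (n / p) p))) ⟩
      + (n % p) - (+ (n % p) + + (n / p) * + p)
        ≡⟨ cancel (+ (n % p)) (+ (n / p)) (+ p) ⟩
      - + (n / p) * + p ∎))
      where
      open ≡-Reasoning
      cancel : ∀ r q m → r - (r + q * m) ≡ - q * m
      cancel = solve-∀

    ι-⊕ : ∀ x y → ι (x ⊕ y) ≡ₚ ι x + ι y
    ι-⊕ x y = subst (ι (x ⊕ y) ≡ₚ_) (ℤ.pos-+ (toℕ x) (toℕ y)) (ι-mod (toℕ x ℕ.+ toℕ y))

    ι-⊗ : ∀ x y → ι (x ⊗ y) ≡ₚ ι x * ι y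
    ι-⊗ x y = subst (ι (x ⊗ y) ≡ₚ_) (ℤ.pos-* (toℕ x) (toℕ y)) (ι-mod (toℕ x ℕ.* toℕ y))

    ι-⊖ : ∀ x y → ι (x ⊖ y) ≡ₚ ι x - ι y
    ι-⊖ x y = ≡ₚ-trans (ι-mod (toℕ x ℕ.+ (p ℕ.∸ toℕ y))) (mod-p (divides (+ 1) (begin
      + (toℕ x ℕ.+ (p ℕ.∸ toℕ y)) - (ι x - ι y)
        ≡⟨ cong (_- (ι x - ι y)) (trans (ℤ.pos-+ (toℕ x) _) (cong (λ m → ι x + m) p∸y)) ⟩
      (ι x + (+ p - ι y)) - (ι x - ι y)
        ≡⟨ difference (ι x) (+ p) (ι y) ⟩
      + 1 * + p ∎)))
      where
      open ≡-Reasoning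
      p∸y : + (p ℕ.∸ toℕ y) ≡ + p - ι y
      p∸y = sym (trans (ℤ.[+m]-[+n]≡m⊖n p (toℕ y)) (ℤ.⊖-≥ (ℕ.<⇒≤ (toℕ<n y))))
      difference : ∀ x m y → (x + (m - y)) - (x - y) ≡ + 1 * m
      difference = solve-∀

    small-multiple : ∀ {a} → ∣ a ∣ ℕ.< p → + p ∣ a → a ≡ + 0
    small-multiple {a} ∣a∣<p p∣a = ℤ.∣i∣≡0⇒i≡0 (below ∣ a ∣ ∣a∣<p (∣⇒∣ᵤ p∣a))
      where
      below : ∀ m → m ℕ.< p → p ∣ℕ m → m ≡ 0
      below zero    _   _   = refl
      below (suc m) m<p p∣m = ⊥-elim (>⇒∤ m<p p∣m)

    ≡ₚ⇒≡ : ∀ {x y} → ι x ≡ₚ ι y → x ≡ y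
    ≡ₚ⇒≡ {x} {y} x≡y = toℕ-injective (ℤ.+-injective
      (ℤ.i-j≡0⇒i≡j (ι x) (ι y) (small-multiple ∣x-y∣<p (_≡ₚ_.p∣a-b x≡y))))
      where
      ∣x-y∣<p : ∣ ι x - ι y ∣ ℕ.< p
      ∣x-y∣<p = ℕ.≤-<-trans
        (subst (ℕ._≤ toℕ x ℕ.⊔ toℕ y) (cong ∣_∣ (sym (ℤ.[+m]-[+n]≡m⊖n (toℕ x) (toℕ y))))
               (ℤ.∣m⊝n∣≤m⊔n (toℕ x) (toℕ y)))
        (ℕ.⊔-lub (toℕ<n x) (toℕ<n y))

    p∣ι⇒toℕ≡0 : ∀ {x} → + p ∣ ι x → toℕ x ≡ 0
    p∣ι⇒toℕ≡0 {x} p∣x = ℤ.+-injective (small-multiple (toℕ<n x) p∣x)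

    euclid : Prime p → ∀ {a b} → + p ∣ a * b → (+ p ∣ a) ⊎ (+ p ∣ b)
    euclid p-prime {a} {b} p∣ab =
      map ∣ᵤ⇒∣ ∣ᵤ⇒∣ (euclidsLemma ∣ a ∣ ∣ b ∣ p-prime (subst (p ∣ℕ_) (ℤ.abs-* a b) (∣⇒∣ᵤ p∣ab)))

    ≡ₚ-reflexive : ∀ {a b} → a ≡ b → a ≡ₚ b
    ≡ₚ-reflexive refl = ≡ₚ-refl

    ≡ₚ0⇒p∣ : ∀ {a} → a ≡ₚ + 0 → + p ∣ a
    ≡ₚ0⇒p∣ {a} (mod-p p∣a) = subst (+ p ∣_) (ℤ.+-identityʳ a) p∣a

    ≡⇒≡ₚ : ∀ {x y a b} → ι x ≡ₚ a → ι y ≡ₚ b → x ≡ y → a ≡ₚ b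
    ≡⇒≡ₚ x≡a y≡b refl = ≡ₚ-trans (≡ₚ-sym x≡a) y≡b

    ≡ₚ⇒≡′ : ∀ {x y a b} → ι x ≡ₚ a → ι y ≡ₚ b → a ≡ₚ b → x ≡ y
    ≡ₚ⇒≡′ x≡a y≡b a≡b = ≡ₚ⇒≡ (≡ₚ-trans x≡a (≡ₚ-trans a≡b (≡ₚ-sym y≡b)))

    ι-affine : ∀ t a b → ι ((t ⊗ a) ⊕ b) ≡ₚ ι t * ι a + ι b
    ι-affine t a b = ≡ₚ-trans (ι-⊕ (t ⊗ a) b) (≡ₚ-+ (ι-⊗ t a) ≡ₚ-refl)

    ι-linear : ∀ β μ a b → ι ((β ⊗ a) ⊕ (μ ⊗ b)) ≡ₚ ι β * ι a + ι μ * ι b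
    ι-linear β μ a b = ≡ₚ-trans (ι-⊕ (β ⊗ a) (μ ⊗ b)) (≡ₚ-+ (ι-⊗ β a) (ι-⊗ μ b))

    ⊕-cancelˡ : ∀ u {b e} → u ⊕ b ≡ u ⊕ e → b ≡ e
    ⊕-cancelˡ u {b} {e} u+b≡u+e = ≡ₚ⇒≡ (mod-p (subst (+ p ∣_) (cancel (ι u) (ι b) (ι e))
      (_≡ₚ_.p∣a-b (≡⇒≡ₚ (ι-⊕ u b) (ι-⊕ u e) u+b≡u+e))))
      where cancel : ∀ u b e → (u + b) - (u + e) ≡ b - e
            cancel = solve-∀

    ⊖-nonzero : ∀ {x y} → x ≢ y → toℕ (x ⊖ y) ≢ 0
    ⊖-nonzero {x} {y} x≢y x-y≡0 = x≢y (≡ₚ⇒≡ (mod-p (≡ₚ0⇒p∣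
      (≡ₚ-trans (≡ₚ-sym (ι-⊖ x y)) (≡ₚ-reflexive (cong +_ x-y≡0))))))

    module _ (p-prime : Prime p) where

      affine-collision-unique : ∀ {t t′ a b d e} → a ≢ d →
        (t ⊗ a) ⊕ b ≡ (t ⊗ d) ⊕ e → (t′ ⊗ a) ⊕ b ≡ (t′ ⊗ d) ⊕ e → t ≡ t′
      affine-collision-unique {t} {t′} {a} {b} {d} {e} a≢d on-t on-t′ =
        conclude (euclid p-prime p∣[t-t′][a-d])
        where
        factor : ∀ t t′ a b d e →
          ((t * a + b) - (t * d + e)) - ((t′ * a + b) - (t′ * d + e)) ≡ (t - t′) * (a - d)
        factor = solve-∀
        p∣[t-t′][a-d] : + p ∣ (ι t - ι t′) * (ι a - ι d)
        p∣[t-t′][a-d] = subst (+ p ∣_) (factor (ι t) (ι t′) (ι a) (ι b) (ι d) (ι e))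
          (∣m∣n⇒∣m-n (_≡ₚ_.p∣a-b (≡⇒≡ₚ (ι-affine t a b) (ι-affine t d e) on-t))
                     (_≡ₚ_.p∣a-b (≡⇒≡ₚ (ι-affine t′ a b) (ι-affine t′ d e) on-t′)))
        conclude : (+ p ∣ ι t - ι t′) ⊎ (+ p ∣ ι a - ι d) → t ≡ t′
        conclude (inj₁ p∣t-t′) = ≡ₚ⇒≡ (mod-p p∣t-t′)
        conclude (inj₂ p∣a-d)  = ⊥-elim (a≢d (≡ₚ⇒≡ (mod-p p∣a-d)))

      rescale-collision : ∀ {t μ β a b d e} → t ⊗ μ ≡ β → toℕ μ ≢ 0 →
        (β ⊗ a) ⊕ (μ ⊗ b) ≡ (β ⊗ d) ⊕ (μ ⊗ e) → (t ⊗ a) ⊕ b ≡ (t ⊗ d) ⊕ e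
      rescale-collision {t} {μ} {β} {a} {b} {d} {e} tμ≡β μ≢0 collision =
        conclude (euclid p-prime (subst (+ p ∣_) (factor (ι μ) (ι t * ι a + ι b) (ι t * ι d + ι e))
                                        (_≡ₚ_.p∣a-b scaled)))
        where
        factor : ∀ m x y → m * x - m * y ≡ m * (x - y)
        factor = solve-∀
        expand : ∀ m t a b → m * (t * a + b) ≡ (t * m) * a + m * b
        expand = solve-∀
        ιtμ≡ιβ : ι t * ι μ ≡ₚ ι β
        ιtμ≡ιβ = ≡⇒≡ₚ (ι-⊗ t μ) ≡ₚ-refl tμ≡β
        scaled : ι μ * (ι t * ι a + ι b) ≡ₚ ι μ * (ι t * ι d + ι e)
        scaled = begin
          ι μ * (ι t * ι a + ι b)          ≡⟨ expand (ι μ) (ι t) (ι a) (ι b) ⟩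
          (ι t * ι μ) * ι a + ι μ * ι b    ≈⟨ ≡ₚ-+ (≡ₚ-* ιtμ≡ιβ ≡ₚ-refl) ≡ₚ-refl ⟩
          ι β * ι a + ι μ * ι b            ≈⟨ ≡⇒≡ₚ (ι-linear β μ a b) (ι-linear β μ d e) collision ⟩
          ι β * ι d + ι μ * ι e            ≈⟨ ≡ₚ-+ (≡ₚ-* (≡ₚ-sym ιtμ≡ιβ) ≡ₚ-refl) ≡ₚ-refl ⟩
          (ι t * ι μ) * ι d + ι μ * ι e    ≡⟨ sym (expand (ι μ) (ι t) (ι d) (ι e)) ⟩
          ι μ * (ι t * ι d + ι e)          ∎
          where open ≡ₚ-Reasoning
        conclude : (+ p ∣ ι μ) ⊎ (+ p ∣ (ι t * ι a + ι b) - (ι t * ι d + ι e)) →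
          (t ⊗ a) ⊕ b ≡ (t ⊗ d) ⊕ e
        conclude (inj₁ p∣μ)    = ⊥-elim (μ≢0 (p∣ι⇒toℕ≡0 p∣μ))
        conclude (inj₂ p∣diff) = ≡ₚ⇒≡′ (ι-affine t a b) (ι-affine t d e) (mod-p p∣diff)

      quotient-nonzero : ∀ {t x y u v} → toℕ t ≢ 0 → t ⊗ (x ⊖ y) ≡ u ⊖ v → x ≢ y → u ≢ v
      quotient-nonzero {t} {x} {y} {u} t≢0 t[x-y]≡u-v x≢y refl = conclude (euclid p-prime p∣t[x-y])
        where
        p∣t[x-y] : + p ∣ ι t * (ι x - ι y)
        p∣t[x-y] = ≡ₚ0⇒p∣ (≡⇒≡ₚ (≡ₚ-trans (ι-⊗ t (x ⊖ y)) (≡ₚ-* (≡ₚ-refl {ι t}) (ι-⊖ x y)))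
                               (≡ₚ-trans (ι-⊖ u u) (≡ₚ-reflexive (ℤ.+-inverseʳ (ι u))))
                               t[x-y]≡u-v)
        conclude : (+ p ∣ ι t) ⊎ (+ p ∣ ι x - ι y) → ⊥
        conclude (inj₁ p∣t)   = t≢0 (p∣ι⇒toℕ≡0 p∣t)
        conclude (inj₂ p∣x-y) = x≢y (≡ₚ⇒≡ (mod-p p∣x-y))

module Rationals where

  open import Data.Nat as ℕ using (ℕ; suc)
  import Data.Nat.Properties as ℕ
  open import Data.Integer as ℤ using (+_; +[1+_])
  import Data.Integer.Properties as ℤ
  open import Data.Rational using (ℚ; mkℚ; Positive; _≤_; _*_; toℚᵘ; ↧ₙ_)
  open import Data.Rational.Properties using (toℚᵘ-mono-≤; toℚᵘ-cancel-≤; toℚᵘ-homo-*; toℚᵘ-fromℚᵘ)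
  open import Data.Rational.Unnormalised as ℚᵘ using (mkℚᵘ; *≤*) renaming (_≃_ to _≃ᵘ_)
  import Data.Rational.Unnormalised.Properties as ℚᵘ
  open import Relation.Binary.PropositionalEquality
  open import Defs using (ℕ→ℚ)

  toℚᵘ-ℕ→ℚ : ∀ n → toℚᵘ (ℕ→ℚ n) ≃ᵘ mkℚᵘ (+ n) 0
  toℚᵘ-ℕ→ℚ n = toℚᵘ-fromℚᵘ (mkℚᵘ (+ n) 0)

  ℕ→ℚ-≤-* : ∀ m c s → m ℕ.≤ c ℕ.* s → ℕ→ℚ m ≤ ℕ→ℚ c * ℕ→ℚ s
  ℕ→ℚ-≤-* m c s m≤cs = toℚᵘ-cancel-≤
    (ℚᵘ.≤-respˡ-≃ (ℚᵘ.≃-sym (toℚᵘ-ℕ→ℚ m))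
    (ℚᵘ.≤-respʳ-≃ (ℚᵘ.≃-sym (ℚᵘ.≃-trans (toℚᵘ-homo-* (ℕ→ℚ c) (ℕ→ℚ s))
                                         (ℚᵘ.*-cong (toℚᵘ-ℕ→ℚ c) (toℚᵘ-ℕ→ℚ s))))
    (*≤* (subst₂ ℤ._≤_ (sym (ℤ.*-identityʳ (+ m))) (trans (ℤ.pos-* c s) (sym (ℤ.*-identityʳ _)))
                       (ℤ.+≤+ m≤cs)))))

  clear-denominator : ∀ κ → Positive κ → ∀ A B → κ * ℕ→ℚ A ≤ ℕ→ℚ B → A ℕ.≤ ↧ₙ κ ℕ.* B
  clear-denominator κ@(mkℚ +[1+ n ] d _) _ A B κA≤B
    with ℚᵘ.≤-respʳ-≃ (toℚᵘ-ℕ→ℚ B)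
           (ℚᵘ.≤-respˡ-≃ (ℚᵘ.≃-trans (toℚᵘ-homo-* κ (ℕ→ℚ A)) (ℚᵘ.*-cong (ℚᵘ.≃-refl {toℚᵘ κ}) (toℚᵘ-ℕ→ℚ A)))
                         (toℚᵘ-mono-≤ κA≤B))
  ... | *≤* [1+n]A≤B[1+d] = ℕ.≤-trans (ℕ.m≤n*m A (suc n)) (subst (suc n ℕ.* A ℕ.≤_)
          (trans (ℕ.*-comm B _) (cong (λ k → suc k ℕ.* B) (ℕ.*-identityʳ d)))
          (ℤ.drop‿+≤+ (subst₂ ℤ._≤_ (trans (ℤ.*-identityʳ _) (ℤ.+◃n≡+n (suc n ℕ.* A)))
                                    (sym (ℤ.pos-* B (suc (d ℕ.* 1)))) [1+n]A≤B[1+d])))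

module Arithmetic where

  open import Data.Nat
  open import Data.Nat.Properties
  open import Relation.Binary.PropositionalEquality
  open import Relation.Nullary using (yes; no)
  open import Data.Nat.Solver using (module +-*-Solver)
  open +-*-Solver using (solve; _:=_; _:+_; _:*_; _:^_; con)

  p≤2[p-1] : ∀ r → suc (suc r) ≤ 2 * suc r
  p≤2[p-1] r = subst (suc (suc r) ≤_) (sym (split r)) (m≤m+n _ r)
    where split : ∀ r → 2 * suc r ≡ suc (suc r) + r
          split = solve 1 (λ r → con 2 :* (con 1 :+ r) := con 2 :+ r :+ r) refl

  min-tradeoff : ∀ p A → 2 ≤ p → (A ^ 2 ⊓ p) * ((p ∸ 1) * A ^ 2 + A ^ 4) ≤ 4 * ((p ∸ 1) * A ^ 4)
  min-tradeoff (suc zero) A (s≤s ())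
  min-tradeoff p@(suc q@(suc r)) A _ with A ^ 2 ≤? p
  ... | yes A²≤p = begin
    (A ^ 2 ⊓ p) * (q * A ^ 2 + A ^ 4)  ≡⟨ cong (_* (q * A ^ 2 + A ^ 4)) (m≤n⇒m⊓n≡m A²≤p) ⟩
    A ^ 2 * (q * A ^ 2 + A ^ 4)        ≡⟨ expand q A ⟩
    q * A ^ 4 + A ^ 2 * A ^ 4          ≤⟨ +-monoʳ-≤ (q * A ^ 4) (*-monoˡ-≤ (A ^ 4) (≤-trans A²≤p (p≤2[p-1] r))) ⟩
    q * A ^ 4 + (2 * q) * A ^ 4        ≡⟨ collect q A ⟩
    3 * (q * A ^ 4)                    ≤⟨ *-monoˡ-≤ (q * A ^ 4) (n≤1+n 3) ⟩
    4 * (q * A ^ 4)                    ∎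
    where
    open ≤-Reasoning
    expand : ∀ x a → a ^ 2 * (x * a ^ 2 + a ^ 4) ≡ x * a ^ 4 + a ^ 2 * a ^ 4
    expand = solve 2 (λ x a → a :^ 2 :* (x :* a :^ 2 :+ a :^ 4) := x :* a :^ 4 :+ a :^ 2 :* a :^ 4) refl
    collect : ∀ x a → x * a ^ 4 + (2 * x) * a ^ 4 ≡ 3 * (x * a ^ 4)
    collect = solve 2 (λ x a → x :* a :^ 4 :+ (con 2 :* x) :* a :^ 4 := con 3 :* (x :* a :^ 4)) refl
  ... | no A²≰p = begin
    (A ^ 2 ⊓ p) * (q * A ^ 2 + A ^ 4)  ≡⟨ cong (_* (q * A ^ 2 + A ^ 4)) (m≥n⇒m⊓n≡n (<⇒≤ p<A²)) ⟩
    p * (q * A ^ 2 + A ^ 4)            ≤⟨ *-mono-≤ (p≤2[p-1] r) (+-monoˡ-≤ (A ^ 4) (*-monoˡ-≤ (A ^ 2) q≤A²)) ⟩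
    (2 * q) * (A ^ 2 * A ^ 2 + A ^ 4)  ≡⟨ collect q A ⟩
    4 * (q * A ^ 4)                    ∎
    where
    open ≤-Reasoning
    p<A² : p < A ^ 2
    p<A² = ≰⇒> A²≰p
    q≤A² : q ≤ A ^ 2
    q≤A² = ≤-trans (n≤1+n q) (<⇒≤ p<A²)
    collect : ∀ x a → (2 * x) * (a ^ 2 * a ^ 2 + a ^ 4) ≡ 4 * (x * a ^ 4)
    collect = solve 2 (λ x a → (con 2 :* x) :* (a :^ 2 :* a :^ 2 :+ a :^ 4) := con 4 :* (x :* a :^ 4)) refl

  -- The final estimate, from A ≤ D·B (density of the subset), B⁴ ≤ s·E
  -- (Cauchy–Schwarz) and q·E ≤ q·A² + A⁴ (choice of a low-energy slope).
  sumset-bound : ∀ p A B D s E → 2 ≤ p → A ≤ D * B → B ^ 4 ≤ s * E →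
    (p ∸ 1) * E ≤ (p ∸ 1) * A ^ 2 + A ^ 4 → A ^ 2 ⊓ p ≤ 4 * D ^ 4 * s
  sumset-bound p zero B D s E _ _ _ _ = z≤n
  sumset-bound (suc zero) (suc _) B D s E (s≤s ()) _ _ _
  sumset-bound p@(suc q@(suc r)) A@(suc _) B D s E 2≤p A≤DB B⁴≤sE qE≤ =
    *-cancelʳ-≤ m (4 * D ^ 4 * s) (q * A ^ 4) (begin
      m * (q * A ^ 4)                    ≤⟨ *-monoʳ-≤ m (*-monoʳ-≤ q A⁴≤D⁴B⁴) ⟩
      m * (q * (D ^ 4 * B ^ 4))          ≤⟨ *-monoʳ-≤ m (*-monoʳ-≤ q (*-monoʳ-≤ (D ^ 4) B⁴≤sE)) ⟩
      m * (q * (D ^ 4 * (s * E)))        ≡⟨ regroup m q D s E ⟩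
      (D ^ 4 * s) * (m * (q * E))        ≤⟨ *-monoʳ-≤ (D ^ 4 * s) (*-monoʳ-≤ m qE≤) ⟩
      (D ^ 4 * s) * (m * (q * A ^ 2 + A ^ 4)) ≤⟨ *-monoʳ-≤ (D ^ 4 * s) (min-tradeoff p A 2≤p) ⟩
      (D ^ 4 * s) * (4 * (q * A ^ 4))    ≡⟨ regroup′ D s (q * A ^ 4) ⟩
      4 * D ^ 4 * s * (q * A ^ 4)        ∎)
    where
    open ≤-Reasoning
    m = A ^ 2 ⊓ p
    A⁴≤D⁴B⁴ : A ^ 4 ≤ D ^ 4 * B ^ 4
    A⁴≤D⁴B⁴ = subst (A ^ 4 ≤_) (power D B) (^-monoˡ-≤ 4 A≤DB)
      where power : ∀ x y → (x * y) ^ 4 ≡ x ^ 4 * y ^ 4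
            power = solve 2 (λ x y → (x :* y) :^ 4 := x :^ 4 :* y :^ 4) refl
    regroup : ∀ a b c d e → a * (b * (c ^ 4 * (d * e))) ≡ (c ^ 4 * d) * (a * (b * e))
    regroup = solve 5 (λ a b c d e → a :* (b :* (c :^ 4 :* (d :* e))) := (c :^ 4 :* d) :* (a :* (b :* e))) refl
    regroup′ : ∀ a b c → (a ^ 4 * b) * (4 * c) ≡ 4 * a ^ 4 * b * c
    regroup′ = solve 3 (λ a b c → (a :^ 4 :* b) :* (con 4 :* c) := con 4 :* a :^ 4 :* b :* c) refl

module AffineEnergy where

  open import Defs
  open FiniteSums
  open Energy
  open Residues

  open import Data.Nat using (ℕ; NonZero; zero; suc; _+_; _*_; _∸_; _^_; _≤_; z≤n; nonTrivial⇒n>1)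
  open import Data.Nat.Properties
  open import Data.Nat.Primality using (Prime; prime⇒nonTrivial)
  open import Data.Nat.Solver using (module +-*-Solver)
  open import Data.Fin using (Fin; toℕ)
  open import Data.Fin.Properties using () renaming (_≟_ to _≟ᶠ_)
  open import Data.Fin.Subset using (Subset; _∈_; _⊆_; ∣_∣)
  open import Data.Fin.Subset.Properties using (_∈?_)
  open import Data.Vec.Properties using (lookup∘tabulate; lookup⇒[]=)
  open import Data.Bool.Properties using (T-≡)
  open import Data.Product using (∃; _×_; _,_)
  open import Data.Empty using (⊥-elim)
  open import Function.Bundles using (Equivalence)
  open import Relation.Nullary using (yes; no; ¬?)
  open import Function using (_∘_)
  open import Relation.Nullary.Decidable using (fromWitness)
  open import Relation.Binary.PropositionalEquality
  open import Algebra.Properties.Semiring.Sum +-*-semiring using (sum)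

  sum-isNonZero : ∀ n → sum {n} (λ t → isNonZero (toℕ t)) ≡ n ∸ 1
  sum-isNonZero zero    = refl
  sum-isNonZero (suc n) = trans (sum-const n 1) (*-identityʳ n)

  module _ {p : ℕ} .{{_ : NonZero p}} where

    affine : Fin p → Fin p → Fin p → Fin p
    affine t a b = (t ⊗ a) ⊕ b

    linear : Fin p → Fin p → Fin p → Fin p → Fin p
    linear β μ a b = (β ⊗ a) ⊕ (μ ⊗ b)

    ∈-dilSum : ∀ {β μ X Y x y z} → x ∈ X → y ∈ Y → linear β μ x y ≡ z → z ∈ dilSum β X μ Y
    ∈-dilSum {z = z} x∈X y∈Y βx+μy≡z = lookup⇒[]= z _
      (trans (lookup∘tabulate _ z) (Equivalence.to T-≡ (fromWitness (_ , _ , x∈X , y∈Y , βx+μy≡z))))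

    -- Every point with a representation lies in the sumset, so by Cauchy–Schwarz
    -- |Y|⁴ ≤ |β·Y + μ·Y| · E(β·Y + μ·Y).
    sumset-energy : ∀ β μ (Y : Subset p) →
      ∣ Y ∣ ^ 4 ≤ ∣ dilSum β Y μ Y ∣ * energy (linear β μ) (indicator Y)
    sumset-energy β μ Y = subst (_≤ ∣ dilSum β Y μ Y ∣ * energy (linear β μ) (indicator Y))
      (fourth-power ∣ Y ∣ (∣X∣≡sum Y))
      (energy-bound (linear β μ) (indicator Y) (dilSum β Y μ Y) represented⇒∈)
      where
      open +-*-Solver using (solve; _:=_; _:*_; _:^_)
      fourth-power : ∀ n {s} → n ≡ s → (s * s) * (s * s) ≡ n ^ 4
      fourth-power n refl = solve 1 (λ s → (s :* s) :* (s :* s) := s :^ 4) refl n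
      represented⇒∈ : ∀ z → representations (linear β μ) (indicator Y) z ≢ 0 → z ∈ dilSum β Y μ Y
      represented⇒∈ z r≢0 with Σ≢0⇒ (indicator Y) (λ y₁ → Σ⟨ indicator Y ⟩ (λ y₂ → 𝟙 (linear β μ y₁ y₂ ≟ᶠ z))) r≢0
      ... | y₁ , y₁∈Y , r₁≢0 with Σ≢0⇒ (indicator Y) (λ y₂ → 𝟙 (linear β μ y₁ y₂ ≟ᶠ z)) r₁≢0
      ...   | y₂ , y₂∈Y , hit =
        ∈-dilSum {β} {μ} (𝟙≢0⇒ (y₁ ∈? Y) y₁∈Y) (𝟙≢0⇒ (y₂ ∈? Y) y₂∈Y) (𝟙≢0⇒ (linear β μ y₁ y₂ ≟ᶠ z) hit)

    module _ (p-prime : Prime p) where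

      2≤p : 2 ≤ p
      2≤p = nonTrivial⇒n>1 p {{prime⇒nonTrivial p-prime}}

      collision-count : ∀ a b d e →
        sum (λ t → isNonZero (toℕ t) * 𝟙 (affine t d e ≟ᶠ affine t a b))
          ≤ (p ∸ 1) * (𝟙 (a ≟ᶠ d) * 𝟙 (b ≟ᶠ e)) + 1
      collision-count a b d e with a ≟ᶠ d | b ≟ᶠ e
      ... | yes refl | yes refl = ≤-trans
        (sum-mono (λ t → ≤-trans (*-monoʳ-≤ (isNonZero (toℕ t)) (𝟙≤1 (affine t a b ≟ᶠ affine t a b)))
                                 (≤-reflexive (*-identityʳ _))))
        (≤-trans (≤-reflexive (trans (sum-isNonZero p) (sym (*-identityʳ (p ∸ 1))))) (m≤m+n _ 1))
      ... | yes refl | no b≢e = ≤-trans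
        (sum-mono (λ t → ≤-reflexive (trans (cong (isNonZero (toℕ t) *_) (no-collision t)) (*-zeroʳ (isNonZero (toℕ t))))))
        (≤-trans (≤-reflexive (sum-zero p)) z≤n)
        where
        no-collision : ∀ t → 𝟙 (affine t a e ≟ᶠ affine t a b) ≡ 0
        no-collision t with affine t a e ≟ᶠ affine t a b
        ... | yes collide = ⊥-elim (b≢e (sym (⊕-cancelˡ (t ⊗ a) collide)))
        ... | no _        = refl
      ... | no a≢d | _ = ≤-trans
        (sum-mono (λ t → ≤-trans (*-monoˡ-≤ (𝟙 (affine t d e ≟ᶠ affine t a b)) (𝟙≤1 (¬? (toℕ t ≟ 0))))
                                 (≤-reflexive (*-identityˡ (𝟙 (affine t d e ≟ᶠ affine t a b))))))
        (≤-trans (sum-𝟙-unique (λ t → affine t d e ≟ᶠ affine t a b)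
                   (λ t t′ → affine-collision-unique p-prime (a≢d ∘ sym)))
                 (m≤n+m 1 _))

      sum-affine-energy : (X : Subset p) → let N = sum (indicator X) in
        sum (λ t → isNonZero (toℕ t) * energy (affine t) (indicator X))
          ≤ N * (N * ((p ∸ 1) * 1 + N * (N * 1)))
      sum-affine-energy X = begin
        sum (λ t → nz t * energy (affine t) w)
          ≡⟨ Σ²-interchange w nz (λ t a b → representations (affine t) w (affine t a b)) ⟩
        Σ²⟨ w ⟩ (λ a b → sum (λ t → nz t * representations (affine t) w (affine t a b)))
          ≡⟨ Σ²-cong w (λ a b → Σ²-interchange w nz (λ t d e → 𝟙 (affine t d e ≟ᶠ affine t a b))) ⟩
        Σ²⟨ w ⟩ (λ a b → Σ²⟨ w ⟩ (λ d e → sum (λ t → nz t * 𝟙 (affine t d e ≟ᶠ affine t a b))))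
          ≤⟨ Σ²-mono {w = w} {w} (λ _ → ≤-refl) (λ a b → Σ²-mono {w = w} {w} (λ _ → ≤-refl) (collision-count a b)) ⟩
        Σ²⟨ w ⟩ (λ a b → Σ²⟨ w ⟩ (λ d e → q * (𝟙 (a ≟ᶠ d) * 𝟙 (b ≟ᶠ e)) + 1))
          ≡⟨ Σ²-cong w diagonal+rest ⟩
        Σ²⟨ w ⟩ (λ a b → q * (w a * w b) + N * (N * 1))
          ≤⟨ Σ²-mono {w = w} {w} (λ _ → ≤-refl) (λ a b → +-monoˡ-≤ (N * (N * 1))
               (*-monoʳ-≤ q (*-mono-≤ (indicator≤1 X a) (indicator≤1 X b)))) ⟩
        Σ²⟨ w ⟩ (λ _ _ → q * 1 + N * (N * 1))
          ≡⟨ Σ²-const w (q * 1 + N * (N * 1)) ⟩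
        N * (N * (q * 1 + N * (N * 1))) ∎
        where
        open ≤-Reasoning
        q = p ∸ 1
        w = indicator X
        N = sum w
        nz : Fin p → ℕ
        nz t = isNonZero (toℕ t)
        diagonal+rest : ∀ a b →
          Σ²⟨ w ⟩ (λ d e → q * (𝟙 (a ≟ᶠ d) * 𝟙 (b ≟ᶠ e)) + 1) ≡ q * (w a * w b) + N * (N * 1)
        diagonal+rest a b = trans (Σ²-+ w _ (λ _ _ → 1)) (cong₂ _+_
          (trans (sym (Σ²-*ˡ w q (λ d e → 𝟙 (a ≟ᶠ d) * 𝟙 (b ≟ᶠ e)))) (cong (q *_) (Σ²-delta w a b)))
          (Σ²-const w 1))

      low-energy-slope : (X : Subset p) → ∃ λ t → toℕ t ≢ 0 ×
        (p ∸ 1) * energy (affine t) (indicator X) ≤ (p ∸ 1) * ∣ X ∣ ^ 2 + ∣ X ∣ ^ 4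
      low-energy-slope X = conclude (averaging nz energies (subst (_≢ 0) (sym (sum-isNonZero p)) p∸1≢0))
        where
        nz : Fin p → ℕ
        nz t = isNonZero (toℕ t)
        energies : Fin p → ℕ
        energies t = energy (affine t) (indicator X)
        p∸1≢0 : p ∸ 1 ≢ 0
        p∸1≢0 = m>n⇒m∸n≢0 2≤p
        open +-*-Solver using (solve; _:=_; _:+_; _:*_; _:^_; con)
        normalise : ∀ n q {N} → n ≡ N →
          N * (N * (q * 1 + N * (N * 1))) ≡ q * n ^ 2 + n ^ 4
        normalise n q refl = solve 2 (λ N q → N :* (N :* (q :* con 1 :+ N :* (N :* con 1)))
                                              := q :* N :^ 2 :+ N :^ 4) refl n q
        conclude : (∃ λ t → nz t ≢ 0 × sum nz * energies t ≤ Σ⟨ nz ⟩ energies) →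
          ∃ λ t → toℕ t ≢ 0 × (p ∸ 1) * energies t ≤ (p ∸ 1) * ∣ X ∣ ^ 2 + ∣ X ∣ ^ 4
        conclude (t , nz≢0 , average) = t , 𝟙≢0⇒ (¬? (toℕ t ≟ 0)) nz≢0 , (begin
          (p ∸ 1) * energies t   ≡⟨ cong (_* energies t) (sym (sum-isNonZero p)) ⟩
          sum nz * energies t    ≤⟨ average ⟩
          Σ⟨ nz ⟩ energies         ≤⟨ sum-affine-energy X ⟩
          _                        ≡⟨ normalise ∣ X ∣ (p ∸ 1) (∣X∣≡sum X) ⟩
          (p ∸ 1) * ∣ X ∣ ^ 2 + ∣ X ∣ ^ 4 ∎)
          where open ≤-Reasoning

      dilated-sumset-energy : ∀ {t β μ X Y} → t ⊗ μ ≡ β → toℕ μ ≢ 0 → Y ⊆ X →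
        ∣ Y ∣ ^ 4 ≤ ∣ dilSum β Y μ Y ∣ * energy (affine t) (indicator X)
      dilated-sumset-energy {t} {β} {μ} {X} {Y} tμ≡β μ≢0 Y⊆X = ≤-trans (sumset-energy β μ Y)
        (*-monoʳ-≤ ∣ dilSum β Y μ Y ∣ (energy-mono (linear β μ) (affine t)
          (λ x → 𝟙-mono (x ∈? Y) (x ∈? X) Y⊆X) (λ a b d e → rescale-collision p-prime {t} {μ} {β} tμ≡β μ≢0)))

open import Defs
open import Data.Nat using (ℕ; NonZero; _^_; _⊓_)
import Data.Nat as ℕ
open import Data.Nat.Primality using (Prime)
open import Data.Fin.Subset using (Subset; _∈_; _⊆_; ∣_∣)
open import Data.Product using (Σ; ∃; _×_; _,_)
open import Data.Rational using (ℚ; Positive; _≤_; _*_; ↧ₙ_)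
open import Data.Rational.Properties using (normalize-pos)
open import Relation.Nullary using (¬_)
open import Relation.Binary.PropositionalEquality using (_≡_; sym)
open Residues using (⊖-nonzero; quotient-nonzero)
open Rationals using (ℕ→ℚ-≤-*; clear-denominator)
open Arithmetic using (sumset-bound)
open AffineEnergy using (2≤p; low-energy-slope; dilated-sumset-energy)

C : ℚ → ℚ
C κ = ℕ→ℚ (4 ℕ.* ↧ₙ κ ^ 4)

C-positive : (κ : ℚ) → Positive κ → Positive (C κ)
C-positive κ _ = normalize-pos (4 ℕ.* ↧ₙ κ ^ 4) 1

-- Take a slope t ≠ 0 of low energy, write t = (x₁ - x₂)/(x₃ - x₄) with
-- x₁, …, x₄ ∈ A₁, and feed the density of A‴, Cauchy–Schwarz for the dilated
-- sumset and the energy bound into the final numerical estimate.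
lemma2p4 : Σ (ℚ → ℚ) λ C → ((κ : ℚ) → Positive κ → Positive (C κ)) ×
    ((p : ℕ) .{{_ : NonZero p}} → Prime p → (A₁ : Subset p) → QuotientSetIsAll A₁ →
      ∃ λ a₃ → ∃ λ b₃ → ∃ λ c₃ → ∃ λ d₃ →
        a₃ ∈ A₁ × b₃ ∈ A₁ × c₃ ∈ A₁ × d₃ ∈ A₁ × ¬ (a₃ ≡ b₃) ×
        ((κ : ℚ) → Positive κ → (A‴ : Subset p) → A‴ ⊆ A₁ →
          κ * ℕ→ℚ ∣ A₁ ∣ ≤ ℕ→ℚ ∣ A‴ ∣ →
          ℕ→ℚ ((∣ A₁ ∣ ^ 2) ⊓ p)
            ≤ C κ * ℕ→ℚ ∣ dilSum (b₃ ⊖ a₃) A‴ (d₃ ⊖ c₃) A‴ ∣))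
lemma2p4 = C , C-positive , λ p p-prime A₁ quotients →
  let t , t≢0 , low-energy = low-energy-slope p-prime A₁
      x₁ , x₂ , x₃ , x₄ , x₁∈A₁ , x₂∈A₁ , x₃∈A₁ , x₄∈A₁ , x₃≢x₄ , t[x₃-x₄]≡x₁-x₂ = quotients t
  in x₂ , x₁ , x₄ , x₃ , x₂∈A₁ , x₁∈A₁ , x₄∈A₁ , x₃∈A₁
   , (λ x₂≡x₁ → quotient-nonzero p-prime t≢0 t[x₃-x₄]≡x₁-x₂ x₃≢x₄ (sym x₂≡x₁))
   , λ κ κ>0 A‴ A‴⊆A₁ dense →
       let s = ∣ dilSum (x₁ ⊖ x₂) A‴ (x₃ ⊖ x₄) A‴ ∣
       in ℕ→ℚ-≤-* (∣ A₁ ∣ ^ 2 ⊓ p) (4 ℕ.* ↧ₙ κ ^ 4) s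
            (sumset-bound p (∣ A₁ ∣) (∣ A‴ ∣) (↧ₙ κ) s _ (2≤p p-prime)
               (clear-denominator κ κ>0 (∣ A₁ ∣) (∣ A‴ ∣) dense)
               (dilated-sumset-energy p-prime {t} t[x₃-x₄]≡x₁-x₂ (⊖-nonzero x₃≢x₄) A‴⊆A₁)
               low-energy)
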